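{- Let $\mathcal{T}_1$ and $\mathcal{T}_2$ be formal systems based on the same underlying logic (classical, intuitionistic, or minimal first order predicate calculus), such that the language of $\mathcal{T}_2$ is the language of $\mathcal{T}_1$ augmented with a unary operator $\Box$ on formulas, and such that $\mathcal{T}_2$ includes all instances of the $\Box$-axioms $$\Box(A\vee B)\leftrightarrow(\Box A\vee\Box B),\ \Box(A\wedge B)\leftrightarrow(\Box A\wedge\Box B),\ \Box(\exists x)A\leftrightarrow(\exists x)\Box A,\ \Box(\forall x)A\leftrightarrow(\forall x)\Box A,\ \Box(A\to B)\to(\Box A\to\Box B),\ A\to\Box A,$$ and the deduction rule "from $\Box A$ infer $A$". Suppose $\mathcal{T}_2$ weakly interprets $\mathcal{T}_1$. If $\mathcal{T}_2$ is consistent, then $\mathcal{T}_1$ is consistent.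
   Context: $\mathcal{T}_2$ weakly interprets $\mathcal{T}_1$ if, when all occurrences of $\Box$ are deleted from the theorems of $\mathcal{T}_2$, the resulting set of formulas contains all theorems of $\mathcal{T}_1$. A theory is consistent if $\bot$ is not a theorem; $\neg A$ abbreviates $A\to\bot$. Minimal logic is intuitionistic logic without ex falso quodlibet. -}

module Defs where

open import Data.Nat using (ℕ; zero; suc)
open import Data.Bool using (Bool; true; false)
open import Data.Vec using (Vec; []; _∷_)
open import Data.List using (List; []; _∷_)
open import Data.List.Relation.Unary.All using (All)
open import Data.Product using (Σ; _×_; _,_)
open import Data.Empty using (⊥)
open import Data.Unit using (⊤)
open import Relation.Binary.PropositionalEquality using (_≡_)
open import Relation.Nullary using (¬_)

-- First-order signatures (function and relation symbols with arities).
-- Equality, if present, is treated as a relation symbol whose axioms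
-- belong to the nonlogical axioms of a theory.

record Sig : Set₁ where
  field
    Fun    : Set
    funAr  : Fun → ℕ
    Rel    : Set
    relAr  : Rel → ℕ
open Sig public

data Logic : Set where
  classical intuitionistic minimal : Logic

HasEFQ : Logic → Set
HasEFQ classical       = ⊤
HasEFQ intuitionistic  = ⊤
HasEFQ minimal         = ⊥

HasDNE : Logic → Set
HasDNE classical       = ⊤
HasDNE intuitionistic  = ⊥
HasDNE minimal         = ⊥

module _ (S : Sig) where

  data Tm : Set where
    var : ℕ → Tm
    fun : (f : Fun S) → Vec Tm (funAr S f) → Tm

  -- Formulas; the index says whether the unary operator □ is in the
  -- language: Fm false = language of T₁, Fm true = language of T₂.
  data Fm : Bool → Set where
    rel  : ∀ {b} (r : Rel S) → Vec Tm (relAr S r) → Fm b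
    ⊥'   : ∀ {b} → Fm b
    _∧'_ _∨'_ _⇒_ : ∀ {b} → Fm b → Fm b → Fm b
    ∀' ∃' : ∀ {b} → Fm b → Fm b      -- binds de Bruijn variable 0
    □    : Fm true → Fm true

  infixr 6 _∧'_
  infixr 5 _∨'_
  infixr 4 _⇒_

module _ {S : Sig} where

  mutual
    substTm : (ℕ → Tm S) → Tm S → Tm S
    substTm σ (var x)    = σ x
    substTm σ (fun f ts) = fun f (substTms σ ts)

    substTms : ∀ {n} → (ℕ → Tm S) → Vec (Tm S) n → Vec (Tm S) n
    substTms σ []       = []
    substTms σ (t ∷ ts) = substTm σ t ∷ substTms σ ts

  shiftTm : Tm S → Tm S
  shiftTm = substTm (λ x → var (suc x))

  lift : (ℕ → Tm S) → ℕ → Tm S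
  lift σ zero    = var zero
  lift σ (suc x) = shiftTm (σ x)

  substFm : ∀ {b} → (ℕ → Tm S) → Fm S b → Fm S b
  substFm σ (rel r ts) = rel r (substTms σ ts)
  substFm σ ⊥'         = ⊥'
  substFm σ (A ∧' B)   = substFm σ A ∧' substFm σ B
  substFm σ (A ∨' B)   = substFm σ A ∨' substFm σ B
  substFm σ (A ⇒ B)    = substFm σ A ⇒ substFm σ B
  substFm σ (∀' A)     = ∀' (substFm (lift σ) A)
  substFm σ (∃' A)     = ∃' (substFm (lift σ) A)
  substFm σ (□ A)      = □ (substFm σ A)

  shift : ∀ {b} → Fm S b → Fm S b
  shift = substFm (λ x → var (suc x))

  inst : ∀ {b} → Fm S b → Tm S → Fm S b
  inst A t = substFm (λ { zero → t ; (suc x) → var x }) A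

  _⇔_ : ∀ {b} → Fm S b → Fm S b → Fm S b
  A ⇔ B = (A ⇒ B) ∧' (B ⇒ A)

  ¬'_ : ∀ {b} → Fm S b → Fm S b
  ¬' A = A ⇒ ⊥'

  erase : Fm S true → Fm S false
  erase (rel r ts) = rel r ts
  erase ⊥'         = ⊥'
  erase (A ∧' B)   = erase A ∧' erase B
  erase (A ∨' B)   = erase A ∨' erase B
  erase (A ⇒ B)    = erase A ⇒ erase B
  erase (∀' A)     = ∀' (erase A)
  erase (∃' A)     = ∃' (erase A)
  erase (□ A)      = erase A

record FormalSystem (S : Sig) (b : Bool) : Set₁ where
  field
    Ax    : Fm S b → Set
    Rules : List (Fm S b) → Fm S b → Set
open FormalSystem public

data Thm {S : Sig} {b : Bool} (lg : Logic) (T : FormalSystem S b)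
         : Fm S b → Set where
  ax     : ∀ {A} → Ax T A → Thm lg T A
  rule   : ∀ {Ps C} → Rules T Ps C → All (Thm lg T) Ps → Thm lg T C
  mp     : ∀ {A B} → Thm lg T (A ⇒ B) → Thm lg T A → Thm lg T B
  axK    : ∀ {A B} → Thm lg T (A ⇒ B ⇒ A)
  axS    : ∀ {A B C} → Thm lg T ((A ⇒ B ⇒ C) ⇒ (A ⇒ B) ⇒ A ⇒ C)
  ∧I     : ∀ {A B} → Thm lg T (A ⇒ B ⇒ A ∧' B)
  ∧E₁    : ∀ {A B} → Thm lg T (A ∧' B ⇒ A)
  ∧E₂    : ∀ {A B} → Thm lg T (A ∧' B ⇒ B)
  ∨I₁    : ∀ {A B} → Thm lg T (A ⇒ A ∨' B)
  ∨I₂    : ∀ {A B} → Thm lg T (B ⇒ A ∨' B)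
  ∨E     : ∀ {A B C} → Thm lg T ((A ⇒ C) ⇒ (B ⇒ C) ⇒ A ∨' B ⇒ C)
  ∀E     : ∀ {A} (t : Tm S) → Thm lg T (∀' A ⇒ inst A t)
  ∃I     : ∀ {A} (t : Tm S) → Thm lg T (inst A t ⇒ ∃' A)
  gen    : ∀ {A} → Thm lg T A → Thm lg T (∀' A)
  ∀I     : ∀ {A B} → Thm lg T (shift B ⇒ A) → Thm lg T (B ⇒ ∀' A)
  ∃E     : ∀ {A B} → Thm lg T (A ⇒ shift B) → Thm lg T (∃' A ⇒ B)
  efq    : ∀ {A} → HasEFQ lg → Thm lg T (⊥' ⇒ A)
  dne    : ∀ {A} → HasDNE lg → Thm lg T (¬' ¬' A ⇒ A)

Consistent : ∀ {S b} → Logic → FormalSystem S b → Set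
Consistent lg T = ¬ Thm lg T ⊥'

IncludesBoxAxioms : ∀ {S} → FormalSystem S true → Set
IncludesBoxAxioms {S} T =
    (∀ (A B : Fm S true) → Ax T (□ (A ∨' B) ⇔ (□ A ∨' □ B)))
  × (∀ (A B : Fm S true) → Ax T (□ (A ∧' B) ⇔ (□ A ∧' □ B)))
  × (∀ (A : Fm S true) → Ax T (□ (∃' A) ⇔ ∃' (□ A)))
  × (∀ (A : Fm S true) → Ax T (□ (∀' A) ⇔ ∀' (□ A)))
  × (∀ (A B : Fm S true) → Ax T (□ (A ⇒ B) ⇒ (□ A ⇒ □ B)))
  × (∀ (A : Fm S true) → Ax T (A ⇒ □ A))

IncludesBoxRule : ∀ {S} → FormalSystem S true → Set
IncludesBoxRule {S} T = ∀ (A : Fm S true) → Rules T (□ A ∷ []) A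

WeaklyInterprets : ∀ {S} → Logic → FormalSystem S true → FormalSystem S false → Set
WeaklyInterprets {S} lg T₂ T₁ =
  ∀ (A : Fm S false) → Thm lg T₁ A → Σ (Fm S true) λ B → Thm lg T₂ B × erase B ≡ A

-- A theorem of T₂ whose □-deletion is ⊥ can only be □ⁿ⊥, and the rule
-- "from □A infer A" removes the boxes one at a time.  So a T₁-proof of ⊥,
-- transported to T₂ by the weak interpretation, yields a T₂-proof of ⊥.
module Submission where

open import Defs
open import Data.Bool using (true; false)
open import Data.Product using (_,_)
open import Data.List.Relation.Unary.All using ([]; _∷_)
open import Relation.Binary.PropositionalEquality using (_≡_; refl)

Thm-⊥-of-erase≡⊥ : ∀ {S lg} {T : FormalSystem S true} → IncludesBoxRule T
                 → (B : Fm S true) → erase B ≡ ⊥' → Thm lg T B → Thm lg T ⊥'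
Thm-⊥-of-erase≡⊥ unbox ⊥'    refl ⊢B  = ⊢B
Thm-⊥-of-erase≡⊥ unbox (□ B) eq   ⊢□B = Thm-⊥-of-erase≡⊥ unbox B eq (rule (unbox B) (⊢□B ∷ []))

proposition7p1 : (S : Sig) (lg : Logic) (T₁ : FormalSystem S false) (T₂ : FormalSystem S true)
    → IncludesBoxAxioms T₂ → IncludesBoxRule T₂
    → WeaklyInterprets lg T₂ T₁
    → Consistent lg T₂ → Consistent lg T₁
proposition7p1 S lg T₁ T₂ _ unbox interprets consistent₂ ⊢⊥ with interprets ⊥' ⊢⊥
... | B , ⊢B , erase-B≡⊥ = consistent₂ (Thm-⊥-of-erase≡⊥ unbox B erase-B≡⊥ ⊢B)
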